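{- Let $N$ be a neuron, $id,len\in\mathbb{N}$, and suppose $\mathit{One\_input}(N,id,len)$, that $N$ is initial, and that $w_N(id)\ge\tau_N$. Then for every list $\mathit{inp}=[f_1;\dots;f_k]$ of input functions, $$Output_N(\mathit{inp},len)=[f_1(id);\dots;f_k(id)]\mathbin{++}[0].$$
   Context: Booleans are identified with $0$ (false) and $1$ (true). A neuron $N$ consists of an identifier $id_N\in\mathbb{N}$, a weight function $w_N:\mathbb{N}\to\mathbb{Q}$ with $-1\le w_N(x)\le 1$ for all $x$ and $w_N(id_N)=0$, a leak factor $lk_N\in\mathbb{Q}$ with $0\le lk_N\le 1$, a threshold $\tau_N\in\mathbb{Q}$ with $\tau_N>0$, an output list $Output(N)$ of booleans (most recent first) and a current potential $CurPot(N)\in\mathbb{Q}$, subject to: $(\tau_N\le CurPot(N))$ equals the head of $Output(N)$ (the head of an empty list being $0$). An input function is a map $i:\mathbb{N}\to\{0,1\}$; $potential(w,i,len)=\sum_{0\le k<len,\ i(k)=1} w(k)$. The one-step update of $N$ with input function $i$ in an environment of $len$ neurons keeps $id,w,lk,\tau$, sets the new potential $p=potential(w_N,i,len)$ if $\tau_N\le CurPot(N)$ and $p=potential(w_N,i,len)+lk_N\cdot CurPot(N)$ otherwise, and sets the new output list to $(\tau_N\le p)::Output(N)$. For a list of input functions (most recent first), $AfterNsteps(N,[\,],len)=N$ and $AfterNsteps(N,i::\mathit{inp},len)$ is the one-step update of $AfterNsteps(N,\mathit{inp},len)$ with $i$; $Output_N(\mathit{inp},len)$ and $CurPot_N(\mathit{inp},len)$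 denote its output list and current potential. $N$ is initial if $Output(N)=[0]$ and $CurPot(N)=0$. $\mathit{One\_input}(N,id,len)$ means $id<len$ and $w_N(id')=0$ for all $id'\neq id$ with $id'<len$. -}

module Defs where

open import Data.Nat using (ℕ; zero; suc; _<_)
open import Data.Bool using (Bool; true; false; if_then_else_)
open import Data.List using (List; []; _∷_)
open import Data.Rational using (ℚ; 0ℚ; 1ℚ; -_; _+_; _*_; _≤_; _<_; _≤ᵇ_)
open import Relation.Binary.PropositionalEquality using (_≡_; _≢_)

-- Booleans 0/1 are Bool false/true. The test (τ ≤ p) as a boolean is τ ≤ᵇ p.

-- head of an output list; head of the empty list is 0 (false)
headB : List Bool → Bool
headB []      = false
headB (b ∷ _) = b

record Neuron : Set where
  constructor mkNeuron
  field
    Id        : ℕ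
    Weight    : ℕ → ℚ
    Leak      : ℚ
    Tau       : ℚ
    Output    : List Bool
    CurPot    : ℚ
    weight-lo : ∀ x → - 1ℚ ≤ Weight x
    weight-hi : ∀ x → Weight x ≤ 1ℚ
    weight-id : Weight Id ≡ 0ℚ
    leak-lo   : 0ℚ ≤ Leak
    leak-hi   : Leak ≤ 1ℚ
    tau-pos   : 0ℚ Data.Rational.< Tau
    pot-out   : (Tau ≤ᵇ CurPot) ≡ headB Output

open Neuron public

potential : (ℕ → ℚ) → (ℕ → Bool) → ℕ → ℚ
potential w i zero    = 0ℚ
potential w i (suc n) = (if i n then w n else 0ℚ) + potential w i n

newPot : Neuron → (ℕ → Bool) → ℕ → ℚ
newPot N i len =
  if Tau N ≤ᵇ CurPot N
  then potential (Weight N) i len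
  else potential (Weight N) i len + Leak N * CurPot N

NextNeuron : Neuron → (ℕ → Bool) → ℕ → Neuron
NextNeuron N i len = record
  { Id        = Id N
  ; Weight    = Weight N
  ; Leak      = Leak N
  ; Tau       = Tau N
  ; Output    = (Tau N ≤ᵇ newPot N i len) ∷ Output N
  ; CurPot    = newPot N i len
  ; weight-lo = weight-lo N
  ; weight-hi = weight-hi N
  ; weight-id = weight-id N
  ; leak-lo   = leak-lo N
  ; leak-hi   = leak-hi N
  ; tau-pos   = tau-pos N
  ; pot-out   = Relation.Binary.PropositionalEquality.refl
  }

-- input lists are most recent first
AfterNsteps : Neuron → List (ℕ → Bool) → ℕ → Neuron
AfterNsteps N []        len = N
AfterNsteps N (i ∷ inp) len = NextNeuron (AfterNsteps N inp len) i len

OutputN : Neuron → List (ℕ → Bool) → ℕ → List Bool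
OutputN N inp len = Output (AfterNsteps N inp len)

CurPotN : Neuron → List (ℕ → Bool) → ℕ → ℚ
CurPotN N inp len = CurPot (AfterNsteps N inp len)

Initial : Neuron → Set
Initial N = (Output N ≡ false ∷ []) × (CurPot N ≡ 0ℚ)
  where open import Data.Product using (_×_)

One-input : Neuron → ℕ → ℕ → Set
One-input N id len =
  (id Data.Nat.< len) × (∀ id' → id' ≢ id → id' Data.Nat.< len → Weight N id' ≡ 0ℚ)
  where open import Data.Product using (_×_)

{-# OPTIONS --safe #-}
module Submission where

-- With a single input of weight at least the threshold, the potential after
-- each step is that weight when the input spiked and 0 otherwise.  In both
-- cases the leak term of the next update vanishes (either the potential is 0
-- or the neuron fires and is reset), so the neuron never accumulates charge
-- and fires exactly when its input did.

open import Defs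
open import Data.Nat as ℕ using (ℕ; zero; suc)
import Data.Nat.Properties as ℕ
open import Data.Bool using (Bool; true; false; if_then_else_; T)
open import Data.Bool.Properties using (T-≡)
open import Data.List using (List; []; _∷_; map; _++_)
open import Data.Rational using (ℚ; 0ℚ; _+_; _*_; _≤_; _<_; _≤ᵇ_)
import Data.Rational.Properties as ℚ
open import Data.Product using (_,_; proj₁; proj₂)
open import Data.Sum using (_⊎_; inj₁; inj₂)
open import Data.Empty using (⊥-elim)
open import Function.Bundles using (Equivalence)
open import Relation.Nullary using (yes; no; contradiction)
open import Relation.Binary.PropositionalEquality

received : (ℕ → ℚ) → (ℕ → Bool) → ℕ → ℚ
received w i k = if i k then w k else 0ℚ

received-vanishing : ∀ w i {k} → w k ≡ 0ℚ → received w i k ≡ 0ℚ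
received-vanishing w i {k} wk≡0 with i k
... | true  = wk≡0
... | false = refl

module _ {w : ℕ → ℚ} (i : ℕ → Bool) where

  potential-vanishing : ∀ n → (∀ k → k ℕ.< n → w k ≡ 0ℚ) → potential w i n ≡ 0ℚ
  potential-vanishing zero    w≡0 = refl
  potential-vanishing (suc n) w≡0 = begin
    received w i n + potential w i n
      ≡⟨ cong₂ _+_ (received-vanishing w i (w≡0 n ℕ.≤-refl))
                   (potential-vanishing n (λ k k<n → w≡0 k (ℕ.m≤n⇒m≤1+n k<n))) ⟩
    0ℚ + 0ℚ
      ≡⟨ ℚ.+-identityˡ 0ℚ ⟩
    0ℚ ∎
    where open ≡-Reasoning

  potential-one-input : ∀ {id} n → id ℕ.< n → (∀ k → k ≢ id → k ℕ.< n → w k ≡ 0ℚ) →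
                        potential w i n ≡ received w i id
  potential-one-input {id} (suc n) id<1+n w≡0 with n ℕ.≟ id
  ... | yes refl = begin
    received w i n + potential w i n
      ≡⟨ cong (received w i n +_)
              (potential-vanishing n (λ k k<n → w≡0 k (ℕ.<⇒≢ k<n) (ℕ.m≤n⇒m≤1+n k<n))) ⟩
    received w i n + 0ℚ
      ≡⟨ ℚ.+-identityʳ _ ⟩
    received w i n ∎
    where open ≡-Reasoning
  ... | no n≢id = begin
    received w i n + potential w i n
      ≡⟨ cong₂ _+_ (received-vanishing w i (w≡0 n n≢id ℕ.≤-refl))
                   (potential-one-input n id<n (λ k k≢id k<n → w≡0 k k≢id (ℕ.m≤n⇒m≤1+n k<n))) ⟩
    0ℚ + received w i id
      ≡⟨ ℚ.+-identityˡ _ ⟩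
    received w i id ∎
    where
    open ≡-Reasoning
    id<n : id ℕ.< n
    id<n = ℕ.≤∧≢⇒< (ℕ.≤-pred id<1+n) (≢-sym n≢id)

received-zero-or-above : ∀ {τ} w i k → τ ≤ w k → received w i k ≡ 0ℚ ⊎ τ ≤ received w i k
received-zero-or-above w i k τ≤wk with i k
... | true  = inj₂ τ≤wk
... | false = inj₁ refl

<⇒≤ᵇ≡false : ∀ {p q} → q < p → (p ≤ᵇ q) ≡ false
<⇒≤ᵇ≡false {p} {q} q<p with p ≤ᵇ q in p≤ᵇq
... | true  = contradiction (ℚ.<-≤-trans q<p (ℚ.≤ᵇ⇒≤ (subst T (sym p≤ᵇq) _))) (ℚ.<-irrefl refl)
... | false = refl

≤ᵇ-received : ∀ {τ} w i k → 0ℚ < τ → τ ≤ w k → (τ ≤ᵇ received w i k) ≡ i k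
≤ᵇ-received w i k 0<τ τ≤wk with i k
... | true  = Equivalence.to T-≡ (ℚ.≤⇒≤ᵇ τ≤wk)
... | false = <⇒≤ᵇ≡false 0<τ

NoCarry : Neuron → Set
NoCarry M = CurPot M ≡ 0ℚ ⊎ Tau M ≤ CurPot M

newPot-NoCarry : ∀ M i len → NoCarry M → newPot M i len ≡ potential (Weight M) i len
newPot-NoCarry M i len no-carry with Tau M ≤ᵇ CurPot M in fired | no-carry
... | true  | _           = refl
... | false | inj₂ τ≤pot  = ⊥-elim (subst T fired (ℚ.≤⇒≤ᵇ τ≤pot))
... | false | inj₁ pot≡0 = begin
  potential (Weight M) i len + Leak M * CurPot M
    ≡⟨ cong (λ p → potential (Weight M) i len + Leak M * p) pot≡0 ⟩
  potential (Weight M) i len + Leak M * 0ℚ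
    ≡⟨ cong (potential (Weight M) i len +_) (ℚ.*-zeroʳ (Leak M)) ⟩
  potential (Weight M) i len + 0ℚ
    ≡⟨ ℚ.+-identityʳ _ ⟩
  potential (Weight M) i len ∎
  where open ≡-Reasoning

record Relays (id len : ℕ) (M : Neuron) : Set where
  field
    one-input      : One-input M id len
    fires-on-input : Tau M ≤ Weight M id
    no-carry       : NoCarry M

module _ {id len M} (relays : Relays id len M) (i : ℕ → Bool) where
  open Relays relays

  newPot-Relays : newPot M i len ≡ received (Weight M) i id
  newPot-Relays = trans (newPot-NoCarry M i len no-carry)
                        (potential-one-input i len (proj₁ one-input) (proj₂ one-input))

  Relays-NextNeuron : Relays id len (NextNeuron M i len)
  Relays-NextNeuron = record
    { one-input      = one-input
    ; fires-on-input = fires-on-input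
    ; no-carry       = subst (λ p → p ≡ 0ℚ ⊎ Tau M ≤ p) (sym newPot-Relays)
                             (received-zero-or-above (Weight M) i id fires-on-input)
    }

  fires-iff-input : (Tau M ≤ᵇ newPot M i len) ≡ i id
  fires-iff-input = trans (cong (Tau M ≤ᵇ_) newPot-Relays)
                          (≤ᵇ-received (Weight M) i id (tau-pos M) fires-on-input)

Relays-AfterNsteps : ∀ {id len N} → Relays id len N → ∀ inp → Relays id len (AfterNsteps N inp len)
Relays-AfterNsteps relays []        = relays
Relays-AfterNsteps relays (i ∷ inp) = Relays-NextNeuron (Relays-AfterNsteps relays inp) i

Output-AfterNsteps : ∀ {id len N} → Relays id len N → ∀ inp →
                     OutputN N inp len ≡ map (λ f → f id) inp ++ Output N
Output-AfterNsteps relays []        = refl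
Output-AfterNsteps relays (i ∷ inp) =
  cong₂ _∷_ (fires-iff-input (Relays-AfterNsteps relays inp) i) (Output-AfterNsteps relays inp)

proposition4p8 : (N : Neuron) (id len : ℕ) →
    One-input N id len → Initial N → Tau N ≤ Weight N id →
    (inp : List (ℕ → Bool)) →
    OutputN N inp len ≡ map (λ f → f id) inp ++ (false ∷ [])
proposition4p8 N id len one-input (output≡[0] , pot≡0) τ≤w inp = begin
  OutputN N inp len                 ≡⟨ Output-AfterNsteps relays inp ⟩
  map (λ f → f id) inp ++ Output N  ≡⟨ cong (map (λ f → f id) inp ++_) output≡[0] ⟩
  map (λ f → f id) inp ++ false ∷ [] ∎
  where
  open ≡-Reasoning
  relays : Relays id len N
  relays = record { one-input = one-input ; fires-on-input = τ≤w ; no-carry = inj₁ pot≡0 }
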